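{- Let $v$ be a positive integer. If a completely quasi-uniform nested $\mathrm{SQS}(v)$ exists, then $v \equiv 4 \pmod{6}$ and the multiplicity of each pair is either $\frac{v-4}{6}$ or $\frac{v+2}{6}$. More precisely, in a completely quasi-uniform nested $\mathrm{SQS}(v)$ there are exactly $\frac{v(v-1)}{3}$ pairs with multiplicity $\frac{v-4}{6}$ and exactly $\frac{v(v-1)}{6}$ pairs with multiplicity $\frac{v+2}{6}$.
   Context: A Steiner quadruple system $\mathrm{SQS}(v)$ is a pair $(V,\mathcal{B})$ where $V$ is a set of $v$ points and $\mathcal{B}$ is a collection of $4$-subsets of $V$ (blocks) such that every $3$-subset of $V$ lies in exactly one block; it is known that an $\mathrm{SQS}(v)$ exists if and only if $v \equiv 2$ or $4 \pmod 6$. A nested $\mathrm{SQS}(v)$ is a pair $(V,\mathscr{B})$ where $\mathscr{B}$ is a set of unordered pairs $\{\{x,y\},\{z,w\}\}$ of $2$-subsets of $V$ (written $\{x,y\mid z,w\}$, called nested blocks) such that $(V,\mathcal{B})$ with $\mathcal{B}=\{\{x,y,z,w\} : \{x,y\mid z,w\}\in\mathscr{B}\}$ is an $\mathrm{SQS}(v)$; i.e. each block of an SQS is partitioned into two pairs (nested pairs). The multiplicity of a pair $\{x,y\}\in\binom{V}{2}$ is the number of nested blocks in $\mathscr{B}$ having $\{x,y\}$ as one of its two pairs. A nested SQS is quasi-uniform if the multiplicities of the nested pairs (pairs with positive multiplicity) are not all equal but any two of them differ by at most one; it is completely quasi-uniform if moreover every pair in $\binom{V}{2}$ has positive multiplicity.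 -}

module Defs where

open import Data.Nat using (ℕ; _+_; _*_; _∸_; _≤_; _<_)
import Data.Nat as ℕ
open import Data.Fin using (Fin) renaming (_≟_ to _≟ᶠ_; _<_ to _<ᶠ_; _<?_ to _<?ᶠ_)
open import Data.List using (List; length; filter; allFin; cartesianProduct)
open import Data.Product using (_×_; _,_; proj₁; proj₂; Σ; ∃-syntax)
open import Data.Sum using (_⊎_)
open import Data.List.Membership.Propositional using (_∈_)
open import Relation.Nullary using (¬_; Dec)
open import Relation.Nullary.Decidable using (_×-dec_; _⊎-dec_)
open import Relation.Binary.PropositionalEquality using (_≡_; _≢_)

-- A nested block {x,y | z,w} on the point set Fin v:
-- the unordered pair of the 2-subsets {x,y} and {z,w}.
record NBlock (v : ℕ) : Set where
  constructor ⟪_,_∣_,_⟫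
  field
    x y z w : Fin v
open NBlock public

Distinct4 : ∀ {v} → NBlock v → Set
Distinct4 ⟪ x , y ∣ z , w ⟫ =
  x ≢ y × x ≢ z × x ≢ w × y ≢ z × y ≢ w × z ≢ w

_∈B_ : ∀ {v} → Fin v → NBlock v → Set
a ∈B ⟪ x , y ∣ z , w ⟫ = a ≡ x ⊎ a ≡ y ⊎ a ≡ z ⊎ a ≡ w

_∈B?_ : ∀ {v} (a : Fin v) (B : NBlock v) → Dec (a ∈B B)
a ∈B? ⟪ x , y ∣ z , w ⟫ = (a ≟ᶠ x) ⊎-dec ((a ≟ᶠ y) ⊎-dec ((a ≟ᶠ z) ⊎-dec (a ≟ᶠ w)))

ContainsTriple : ∀ {v} → Fin v → Fin v → Fin v → NBlock v → Set
ContainsTriple a b c B = a ∈B B × b ∈B B × c ∈B B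

containsTriple? : ∀ {v} (a b c : Fin v) (B : NBlock v) → Dec (ContainsTriple a b c B)
containsTriple? a b c B = (a ∈B? B) ×-dec ((b ∈B? B) ×-dec (c ∈B? B))

SamePair : ∀ {v} → Fin v → Fin v → Fin v → Fin v → Set
SamePair a b x y = (a ≡ x × b ≡ y) ⊎ (a ≡ y × b ≡ x)

samePair? : ∀ {v} (a b x y : Fin v) → Dec (SamePair a b x y)
samePair? a b x y = ((a ≟ᶠ x) ×-dec (b ≟ᶠ y)) ⊎-dec ((a ≟ᶠ y) ×-dec (b ≟ᶠ x))

HasPair : ∀ {v} → Fin v → Fin v → NBlock v → Set
HasPair a b ⟪ x , y ∣ z , w ⟫ = SamePair a b x y ⊎ SamePair a b z w

hasPair? : ∀ {v} (a b : Fin v) (B : NBlock v) → Dec (HasPair a b B)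
hasPair? a b ⟪ x , y ∣ z , w ⟫ = samePair? a b x y ⊎-dec samePair? a b z w

-- A nested SQS(v): a collection (list) of nested blocks with 4 distinct points each,
-- such that every 3-subset {a,b,c} of Fin v lies in exactly one block.
-- (Exactly-one counting with multiplicity forces the list to have no repeated blocks.)
record NestedSQS (v : ℕ) : Set where
  field
    blocks   : List (NBlock v)
    distinct : ∀ B → B ∈ blocks → Distinct4 B
    steiner  : ∀ (a b c : Fin v) → a ≢ b → a ≢ c → b ≢ c →
               length (filter (containsTriple? a b c) blocks) ≡ 1
open NestedSQS public

mult : ∀ {v} → NestedSQS v → Fin v → Fin v → ℕ
mult S a b = length (filter (hasPair? a b) (blocks S))

-- a 2-subset of Fin v is represented by (a , b) with a ≢ b
-- completely quasi-uniform:
--   every pair has positive multiplicity (so every pair is a nested pair),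
--   any two nested pairs have multiplicities differing by at most one,
--   and the multiplicities are not all equal.
CompletelyQuasiUniform : ∀ {v} → NestedSQS v → Set
CompletelyQuasiUniform {v} S =
  (∀ (a b : Fin v) → a ≢ b → 1 ≤ mult S a b)
  × (∀ (a b c d : Fin v) → a ≢ b → c ≢ d → 1 ≤ mult S a b → 1 ≤ mult S c d →
       mult S a b ≤ mult S c d + 1)
  × (∃[ a ] ∃[ b ] ∃[ c ] ∃[ d ]
       (a ≢ b × c ≢ d × 1 ≤ mult S a b × 1 ≤ mult S c d × mult S a b ≢ mult S c d))

allPairs : (v : ℕ) → List (Fin v × Fin v)
allPairs v = filter (λ p → proj₁ p <?ᶠ proj₂ p) (cartesianProduct (allFin v) (allFin v))

pairsWithMult : ∀ {v} → NestedSQS v → ℕ → ℕ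
pairsWithMult {v} S m = length (filter (λ p → mult S (proj₁ p) (proj₂ p) ℕ.≟ m) (allPairs v))

{-# OPTIONS --safe #-}
module Submission where

-- Let v = 2 + 2λ, where λ is the number of blocks through any two points, and let r be the number of
-- blocks through a point; double counting gives 3r = (v − 1)λ. Each block through a point a contains
-- exactly one nested pair through a, so the multiplicities of the v − 1 pairs at a sum to r. If these
-- multiplicities are m or m + 1, with X pairs at a of multiplicity m + 1, then r = m(v − 1) + X, that is
-- 3X = (2λ + 1)(λ − 3m). Since 0 < X < 2λ + 1, this leaves λ − 3m ∈ {1, 2}, and 2 is excluded modulo 3.
-- Hence λ = 3m + 1, v = 6m + 4 and X = 2m + 1 at every point, and summing over the points counts every
-- pair of each multiplicity twice.

open import Defs
open import Data.Nat using (ℕ; _+_; _*_; _∸_; _<_; _/_; _%_)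
open import Data.Fin using (Fin)
open import Data.Product using (_×_)
open import Data.Sum using (_⊎_)
open import Relation.Binary.PropositionalEquality using (_≡_; _≢_)

open import Algebra.Bundles using (Semiring)
open import Data.Bool.Base using (true; false; if_then_else_)
import Data.Fin as Fin
open import Data.Fin.Properties using (_≟_; _<?_)
import Data.Fin.Properties as Finₚ
open import Data.List.Base
  using (List; []; _∷_; map; _++_; length; filter; tabulate; lookup; allFin; cartesianProduct)
open import Data.List.Membership.Propositional using (_∈_)
open import Data.List.Membership.Propositional.Properties using (∈-lookup)
open import Data.List.Properties
  using (length-++; filter-++; filter-≐; filter-none; map-tabulate; tabulate-lookup)
import Data.List.Relation.Unary.All as All
open import Data.Nat as ℕ using (zero; suc; _≤_)
open import Data.Nat.DivMod using ([m+kn]%n≡m%n; m*n/n≡m; m*n%n≡0)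
open import Data.Nat.Properties
  using ( +-*-semiring; +-assoc; +-comm; +-identityʳ; *-identityˡ; *-identityʳ; *-zeroʳ; *-comm
        ; *-distribˡ-+; *-distribʳ-+; *-distribˡ-∸; +-cancelˡ-≡; +-cancelʳ-≡; *-cancelˡ-≡; suc-injective
        ; ≤-reflexive; ≤-trans; ≤-antisym; ≤-pred; m≤m+n; +-monoˡ-≤; *-monoʳ-≤; *-cancelˡ-≤
        ; <⇒≤; <⇒≢; >⇒≢; ≤⇒≯; n<1+n; m≤n⇒m<n∨m≡n; <-cmp; 1+n≢0
        ; m+n≡0⇒m≡0; m+n∸m≡n; m∸n+n≡m; m∸n≢0⇒n<m )
open import Data.Nat.Tactic.RingSolver using (solve-∀)
open import Data.Product using (_,_; ∃-syntax; assocʳ′; assocˡ′; swap)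
open import Data.Sum using (inj₁; inj₂)
import Data.Sum as Sum
open import Function.Base using (_∘_)
open import Relation.Binary.Definitions using (Tri; tri<; tri≈; tri>)
open import Relation.Binary.PropositionalEquality using (refl; sym; trans; cong; cong₂; ≢-sym; module ≡-Reasoning)
open import Relation.Nullary.Decidable using (Dec; yes; no; does; ¬?; _×-dec_; _⊎-dec_)
open import Relation.Nullary.Negation using (¬_; contradiction)
open import Relation.Unary using (Pred; Decidable; _≐_)

open import Algebra.Properties.Semiring.Sum +-*-semiring
  using (sum-syntax; ∑-distrib-+; ∑-comm; *-distribˡ-sum; *-distribʳ-sum; sum-cong-≗; sum-replicate-zero)
open Semiring +-*-semiring using (+-congˡ; +-congʳ)
open ≡-Reasoning

-- Indicators and finite sums

𝟙 : ∀ {p} {P : Set p} → Dec P → ℕ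
𝟙 P? = if does P? then 1 else 0

module _ {p} {P : Set p} where

  𝟙-yes : P → (P? : Dec P) → 𝟙 P? ≡ 1
  𝟙-yes _ (yes _) = refl
  𝟙-yes p (no ¬p) = contradiction p ¬p

  𝟙-no : ¬ P → (P? : Dec P) → 𝟙 P? ≡ 0
  𝟙-no ¬p (yes p) = contradiction p ¬p
  𝟙-no _  (no _)  = refl

  𝟙+𝟙¬≡1 : (P? : Dec P) → 𝟙 P? + 𝟙 (¬? P?) ≡ 1
  𝟙+𝟙¬≡1 (yes _) = refl
  𝟙+𝟙¬≡1 (no _)  = refl

module _ {p q} {P : Set p} {Q : Set q} where

  𝟙-× : (P? : Dec P) (Q? : Dec Q) → 𝟙 (P? ×-dec Q?) ≡ 𝟙 P? * 𝟙 Q?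
  𝟙-× (yes _) (yes _) = refl
  𝟙-× (yes _) (no _)  = refl
  𝟙-× (no _)  _       = refl

  𝟙-⊎ : ¬ (P × Q) → (P? : Dec P) (Q? : Dec Q) → 𝟙 (P? ⊎-dec Q?) ≡ 𝟙 P? + 𝟙 Q?
  𝟙-⊎ ¬pq (yes p) (yes q) = contradiction (p , q) ¬pq
  𝟙-⊎ _   (yes _) (no _)  = refl
  𝟙-⊎ _   (no _)  (yes _) = refl
  𝟙-⊎ _   (no _)  (no _)  = refl

∑-const : ∀ n k → ∑[ i < n ] k ≡ n * k
∑-const zero    k = refl
∑-const (suc n) k = cong (k +_) (∑-const n k)

∑-δ : ∀ {n} (a : Fin n) → ∑[ c < n ] 𝟙 (c ≟ a) ≡ 1
∑-δ {suc n} Fin.zero    = cong suc (sum-replicate-zero n)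
∑-δ {suc n} (Fin.suc a) = ∑-δ a

∑-δ* : ∀ {n} (a : Fin n) (g : Fin n → ℕ) → ∑[ c < n ] (𝟙 (c ≟ a) * g c) ≡ g a
∑-δ* {suc n} Fin.zero    g = trans (cong (g Fin.zero + 0 +_) (sum-replicate-zero n)) (trans (+-identityʳ _) (+-identityʳ _))
∑-δ* {suc n} (Fin.suc a) g = ∑-δ* a (g ∘ Fin.suc)

∑-*δ : ∀ {n} (k : ℕ) (a : Fin n) → ∑[ c < n ] (k * 𝟙 (c ≟ a)) ≡ k
∑-*δ {n} k a = begin
  ∑[ c < n ] (k * 𝟙 (c ≟ a))  ≡⟨ *-distribˡ-sum k (λ c → 𝟙 (c ≟ a)) ⟨
  k * ∑[ c < n ] 𝟙 (c ≟ a)    ≡⟨ cong (k *_) (∑-δ a) ⟩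
  k * 1                       ≡⟨ *-identityʳ k ⟩
  k                           ∎

∑-extract : ∀ {n} (a : Fin n) (g : Fin n → ℕ) →
            ∑[ c < n ] g c ≡ g a + ∑[ c < n ] (𝟙 (¬? (c ≟ a)) * g c)
∑-extract {n} a g = begin
  ∑[ c < n ] g c
    ≡⟨ sum-cong-≗ split ⟩
  ∑[ c < n ] (𝟙 (c ≟ a) * g c + 𝟙 (¬? (c ≟ a)) * g c)
    ≡⟨ ∑-distrib-+ (λ c → 𝟙 (c ≟ a) * g c) (λ c → 𝟙 (¬? (c ≟ a)) * g c) ⟩
  ∑[ c < n ] (𝟙 (c ≟ a) * g c) + ∑[ c < n ] (𝟙 (¬? (c ≟ a)) * g c)
    ≡⟨ +-congʳ (∑-δ* a g) ⟩
  g a + ∑[ c < n ] (𝟙 (¬? (c ≟ a)) * g c) ∎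
  where
  split : ∀ c → g c ≡ 𝟙 (c ≟ a) * g c + 𝟙 (¬? (c ≟ a)) * g c
  split c = begin
    g c                                        ≡⟨ *-identityˡ (g c) ⟨
    1 * g c                                    ≡⟨ cong (_* g c) (𝟙+𝟙¬≡1 (c ≟ a)) ⟨
    (𝟙 (c ≟ a) + 𝟙 (¬? (c ≟ a))) * g c         ≡⟨ *-distribʳ-+ (g c) (𝟙 (c ≟ a)) (𝟙 (¬? (c ≟ a))) ⟩
    𝟙 (c ≟ a) * g c + 𝟙 (¬? (c ≟ a)) * g c     ∎

∑-term : ∀ {n} (a : Fin n) (g : Fin n → ℕ) → g a ≤ ∑[ c < n ] g c
∑-term a g = ≤-trans (m≤m+n (g a) _) (≤-reflexive (sym (∑-extract a g)))

∑-extract₂ : ∀ {n} {a b : Fin n} → a ≢ b → (g : Fin n → ℕ) →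
             ∑[ c < n ] g c ≡ g a + (g b + ∑[ c < n ] (𝟙 (¬? (c ≟ b)) * (𝟙 (¬? (c ≟ a)) * g c)))
∑-extract₂ {a = a} {b} a≢b g =
  trans (∑-extract a g) (+-congˡ (trans (∑-extract b (λ c → 𝟙 (¬? (c ≟ a)) * g c)) (+-congʳ b-term)))
  where
  b-term : 𝟙 (¬? (b ≟ a)) * g b ≡ g b
  b-term = trans (cong (_* g b) (𝟙-yes (≢-sym a≢b) (¬? (b ≟ a)))) (*-identityˡ (g b))

1+∑-≢ : ∀ {n} (a : Fin n) → 1 + ∑[ c < n ] 𝟙 (¬? (c ≟ a)) ≡ n
1+∑-≢ {n} a = begin
  1 + ∑[ c < n ] 𝟙 (¬? (c ≟ a))       ≡⟨ cong (1 +_) (sum-cong-≗ (λ c → *-identityʳ (𝟙 (¬? (c ≟ a))))) ⟨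
  1 + ∑[ c < n ] (𝟙 (¬? (c ≟ a)) * 1) ≡⟨ ∑-extract a (λ _ → 1) ⟨
  ∑[ c < n ] 1                        ≡⟨ ∑-const n 1 ⟩
  n * 1                               ≡⟨ *-identityʳ n ⟩
  n                                   ∎

∑∑-≢≡2*∑∑-< : ∀ {n} (f : Fin n → Fin n → ℕ) → (∀ i j → f i j ≡ f j i) →
       ∑[ i < n ] ∑[ j < n ] (𝟙 (¬? (j ≟ i)) * f i j) ≡ 2 * ∑[ i < n ] ∑[ j < n ] (𝟙 (i <? j) * f i j)
∑∑-≢≡2*∑∑-< {n} f f-sym = begin
  ∑[ i < n ] ∑[ j < n ] (𝟙 (¬? (j ≟ i)) * f i j)
    ≡⟨ sum-cong-≗ (λ i → trans (sum-cong-≗ (split i)) (∑-distrib-+ (λ j → 𝟙 (i <? j) * f i j) (λ j → 𝟙 (j <? i) * f i j))) ⟩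
  ∑[ i < n ] (∑[ j < n ] (𝟙 (i <? j) * f i j) + ∑[ j < n ] (𝟙 (j <? i) * f i j))
    ≡⟨ ∑-distrib-+ (λ i → ∑[ j < n ] (𝟙 (i <? j) * f i j)) (λ i → ∑[ j < n ] (𝟙 (j <? i) * f i j)) ⟩
  A + ∑[ i < n ] ∑[ j < n ] (𝟙 (j <? i) * f i j)
    ≡⟨ +-congˡ (∑-comm (λ i j → 𝟙 (j <? i) * f i j)) ⟩
  A + ∑[ j < n ] ∑[ i < n ] (𝟙 (j <? i) * f i j)
    ≡⟨ +-congˡ (sum-cong-≗ (λ j → sum-cong-≗ (λ i → cong (𝟙 (j <? i) *_) (f-sym i j)))) ⟩
  A + A
    ≡⟨ +-congˡ (+-identityʳ A) ⟨
  2 * A ∎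
  where
  A : ℕ
  A = ∑[ i < n ] ∑[ j < n ] (𝟙 (i <? j) * f i j)
  trichotomy : ∀ i j → 𝟙 (¬? (j ≟ i)) ≡ 𝟙 (i <? j) + 𝟙 (j <? i)
  trichotomy i j with Finₚ.<-cmp i j
  ... | tri< i<j i≢j j≮i =
    trans (𝟙-yes (≢-sym i≢j) (¬? (j ≟ i))) (sym (cong₂ _+_ (𝟙-yes i<j (i <? j)) (𝟙-no j≮i (j <? i))))
  ... | tri≈ i≮j i≡j j≮i =
    trans (𝟙-no (λ j≢i → j≢i (sym i≡j)) (¬? (j ≟ i))) (sym (cong₂ _+_ (𝟙-no i≮j (i <? j)) (𝟙-no j≮i (j <? i))))
  ... | tri> i≮j i≢j j<i =
    trans (𝟙-yes (≢-sym i≢j) (¬? (j ≟ i))) (sym (cong₂ _+_ (𝟙-no i≮j (i <? j)) (𝟙-yes j<i (j <? i))))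
  split : ∀ i j → 𝟙 (¬? (j ≟ i)) * f i j ≡ 𝟙 (i <? j) * f i j + 𝟙 (j <? i) * f i j
  split i j = trans (cong (_* f i j) (trichotomy i j)) (*-distribʳ-+ (f i j) (𝟙 (i <? j)) (𝟙 (j <? i)))

-- Counting the elements of a list

module _ {a p} {A : Set a} {P : Pred A p} (P? : Decidable P) where

  count-tabulate : ∀ {n} (f : Fin n → A) → length (filter P? (tabulate f)) ≡ ∑[ i < n ] 𝟙 (P? (f i))
  count-tabulate {zero}  f = refl
  count-tabulate {suc n} f with does (P? (f Fin.zero))
  ... | true  = cong suc (count-tabulate (f ∘ Fin.suc))
  ... | false = count-tabulate (f ∘ Fin.suc)

  count-lookup : (xs : List A) → length (filter P? xs) ≡ ∑[ i < length xs ] 𝟙 (P? (lookup xs i))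
  count-lookup xs = trans (cong (length ∘ filter P?) (sym (tabulate-lookup xs))) (count-tabulate (lookup xs))

  count-++ : (xs ys : List A) → length (filter P? (xs ++ ys)) ≡ length (filter P? xs) + length (filter P? ys)
  count-++ xs ys = trans (cong length (filter-++ P? xs ys)) (length-++ (filter P? xs))

  count-filter : ∀ {q} {Q : Pred A q} (Q? : Decidable Q) (xs : List A) →
                 length (filter P? (filter Q? xs)) ≡ length (filter (λ x → Q? x ×-dec P? x) xs)
  count-filter Q? []       = refl
  count-filter Q? (x ∷ xs) with does (Q? x)
  ... | false = count-filter Q? xs
  ... | true with does (P? x)
  ...   | true  = cong suc (count-filter Q? xs)
  ...   | false = count-filter Q? xs

module _ {a b p} {A : Set a} {B : Set b} {P : Pred (A × B) p} (P? : Decidable P) where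

  count-cartesianProduct : ∀ {m n} (f : Fin m → A) (g : Fin n → B) →
    length (filter P? (cartesianProduct (tabulate f) (tabulate g))) ≡ ∑[ i < m ] ∑[ j < n ] 𝟙 (P? (f i , g j))
  count-cartesianProduct {zero}  f g = refl
  count-cartesianProduct {suc m} f g = begin
    length (filter P? (row ++ rest))
      ≡⟨ count-++ P? row rest ⟩
    length (filter P? row) + length (filter P? rest)
      ≡⟨ +-congʳ (cong (length ∘ filter P?) (map-tabulate g (f Fin.zero ,_))) ⟩
    length (filter P? (tabulate ((f Fin.zero ,_) ∘ g))) + length (filter P? rest)
      ≡⟨ cong₂ _+_ (count-tabulate P? ((f Fin.zero ,_) ∘ g)) (count-cartesianProduct (f ∘ Fin.suc) g) ⟩
    ∑[ i < suc m ] ∑[ j < _ ] 𝟙 (P? (f i , g j)) ∎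
    where
    row : List (A × B)
    row = map (f Fin.zero ,_) (tabulate g)
    rest : List (A × B)
    rest = cartesianProduct (tabulate (f ∘ Fin.suc)) (tabulate g)

count-≐ : ∀ {a p q} {A : Set a} {P : Pred A p} {Q : Pred A q} (P? : Decidable P) (Q? : Decidable Q) →
          P ≐ Q → (xs : List A) → length (filter P? xs) ≡ length (filter Q? xs)
count-≐ P? Q? P≐Q xs = cong length (filter-≐ P? Q? P≐Q xs)

-- Blocks

module _ {v : ℕ} where

  𝟙-∈B : (B : NBlock v) → Distinct4 B → ∀ c →
         𝟙 (c ∈B? B) ≡ 𝟙 (c ≟ x B) + (𝟙 (c ≟ y B) + (𝟙 (c ≟ z B) + 𝟙 (c ≟ w B)))
  𝟙-∈B ⟪ x , y ∣ z , w ⟫ (x≢y , x≢z , x≢w , y≢z , y≢w , z≢w) c =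
    trans (𝟙-⊎ at-x (c ≟ x) ((c ≟ y) ⊎-dec ((c ≟ z) ⊎-dec (c ≟ w))))
      (+-congˡ (trans (𝟙-⊎ at-y (c ≟ y) ((c ≟ z) ⊎-dec (c ≟ w))) (+-congˡ (𝟙-⊎ at-z (c ≟ z) (c ≟ w)))))
    where
    at-x : ¬ (c ≡ x × (c ≡ y ⊎ c ≡ z ⊎ c ≡ w))
    at-x (refl , inj₁ refl)        = x≢y refl
    at-x (refl , inj₂ (inj₁ refl)) = x≢z refl
    at-x (refl , inj₂ (inj₂ refl)) = x≢w refl
    at-y : ¬ (c ≡ y × (c ≡ z ⊎ c ≡ w))
    at-y (refl , inj₁ refl) = y≢z refl
    at-y (refl , inj₂ refl) = y≢w refl
    at-z : ¬ (c ≡ z × c ≡ w)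
    at-z (refl , refl) = z≢w refl

  ∑-∈B : (B : NBlock v) → Distinct4 B → ∑[ c < v ] 𝟙 (c ∈B? B) ≡ 4
  ∑-∈B B D =
    trans (sum-cong-≗ (𝟙-∈B B D)) (trans (∑-distrib-+ (δ (x B)) (λ c → δ (y B) c + (δ (z B) c + δ (w B) c)))
      (cong₂ _+_ (∑-δ (x B)) (trans (∑-distrib-+ (δ (y B)) (λ c → δ (z B) c + δ (w B) c))
        (cong₂ _+_ (∑-δ (y B)) (trans (∑-distrib-+ (δ (z B)) (δ (w B))) (cong₂ _+_ (∑-δ (z B)) (∑-δ (w B))))))))
    where
    δ : Fin v → Fin v → ℕ
    δ t c = 𝟙 (c ≟ t)

  ∑-samePair : ∀ {p q} → p ≢ q → ∀ a → ∑[ c < v ] 𝟙 (samePair? a c p q) ≡ 𝟙 (a ≟ p) + 𝟙 (a ≟ q)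
  ∑-samePair {p} {q} p≢q a = begin
    ∑[ c < v ] 𝟙 (samePair? a c p q)
      ≡⟨ sum-cong-≗ split ⟩
    ∑[ c < v ] (𝟙 (a ≟ p) * 𝟙 (c ≟ q) + 𝟙 (a ≟ q) * 𝟙 (c ≟ p))
      ≡⟨ ∑-distrib-+ (λ c → 𝟙 (a ≟ p) * 𝟙 (c ≟ q)) (λ c → 𝟙 (a ≟ q) * 𝟙 (c ≟ p)) ⟩
    ∑[ c < v ] (𝟙 (a ≟ p) * 𝟙 (c ≟ q)) + ∑[ c < v ] (𝟙 (a ≟ q) * 𝟙 (c ≟ p))
      ≡⟨ cong₂ _+_ (∑-*δ (𝟙 (a ≟ p)) q) (∑-*δ (𝟙 (a ≟ q)) p) ⟩
    𝟙 (a ≟ p) + 𝟙 (a ≟ q) ∎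
    where
    split : ∀ c → 𝟙 (samePair? a c p q) ≡ 𝟙 (a ≟ p) * 𝟙 (c ≟ q) + 𝟙 (a ≟ q) * 𝟙 (c ≟ p)
    split c = trans (𝟙-⊎ (λ { ((refl , _) , (a≡q , _)) → p≢q a≡q }) ((a ≟ p) ×-dec (c ≟ q)) ((a ≟ q) ×-dec (c ≟ p)))
                    (cong₂ _+_ (𝟙-× (a ≟ p) (c ≟ q)) (𝟙-× (a ≟ q) (c ≟ p)))

  ∑-hasPair : (B : NBlock v) → Distinct4 B → ∀ a → ∑[ c < v ] 𝟙 (hasPair? a c B) ≡ 𝟙 (a ∈B? B)
  ∑-hasPair B@(⟪ x , y ∣ z , w ⟫) D@(x≢y , x≢z , x≢w , y≢z , y≢w , z≢w) a = begin
    ∑[ c < v ] 𝟙 (hasPair? a c B)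
      ≡⟨ sum-cong-≗ split ⟩
    ∑[ c < v ] (𝟙 (samePair? a c x y) + 𝟙 (samePair? a c z w))
      ≡⟨ ∑-distrib-+ (λ c → 𝟙 (samePair? a c x y)) (λ c → 𝟙 (samePair? a c z w)) ⟩
    ∑[ c < v ] 𝟙 (samePair? a c x y) + ∑[ c < v ] 𝟙 (samePair? a c z w)
      ≡⟨ cong₂ _+_ (∑-samePair x≢y a) (∑-samePair z≢w a) ⟩
    (𝟙 (a ≟ x) + 𝟙 (a ≟ y)) + (𝟙 (a ≟ z) + 𝟙 (a ≟ w))
      ≡⟨ +-assoc (𝟙 (a ≟ x)) _ _ ⟩
    𝟙 (a ≟ x) + (𝟙 (a ≟ y) + (𝟙 (a ≟ z) + 𝟙 (a ≟ w)))
      ≡⟨ 𝟙-∈B B D a ⟨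
    𝟙 (a ∈B? B) ∎
    where
    disjoint : ∀ c → ¬ (SamePair a c x y × SamePair a c z w)
    disjoint c (inj₁ (refl , _) , inj₁ (a≡z , _)) = x≢z a≡z
    disjoint c (inj₁ (refl , _) , inj₂ (a≡w , _)) = x≢w a≡w
    disjoint c (inj₂ (refl , _) , inj₁ (a≡z , _)) = y≢z a≡z
    disjoint c (inj₂ (refl , _) , inj₂ (a≡w , _)) = y≢w a≡w
    split : ∀ c → 𝟙 (hasPair? a c B) ≡ 𝟙 (samePair? a c x y) + 𝟙 (samePair? a c z w)
    split c = 𝟙-⊎ (disjoint c) (samePair? a c x y) (samePair? a c z w)

module _ {v} {bs : List (NBlock v)} (distinct : ∀ B → B ∈ bs → Distinct4 B) where

  private
    block : Fin (length bs) → NBlock v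
    block = lookup bs

    block-distinct : ∀ i → Distinct4 (block i)
    block-distinct i = distinct (block i) (∈-lookup i)

  ∑-count-comm : ∀ {p} {P : Fin v → Pred (NBlock v) p} (P? : ∀ c → Decidable (P c)) →
            ∑[ c < v ] length (filter (P? c) bs) ≡ ∑[ i < length bs ] ∑[ c < v ] 𝟙 (P? c (block i))
  ∑-count-comm P? = trans (sum-cong-≗ (λ c → count-lookup (P? c) bs)) (∑-comm (λ c i → 𝟙 (P? c (block i))))

  ∑-count-∈B : ∀ {q} {Q : Pred (NBlock v) q} (Q? : Decidable Q) →
               ∑[ c < v ] length (filter (λ B → Q? B ×-dec (c ∈B? B)) bs) ≡ 4 * length (filter Q? bs)
  ∑-count-∈B Q? = begin
    ∑[ c < v ] length (filter (λ B → Q? B ×-dec (c ∈B? B)) bs)    ≡⟨ ∑-count-comm (λ c B → Q? B ×-dec (c ∈B? B)) ⟩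
    ∑[ i < length bs ] ∑[ c < v ] 𝟙 (Q? (block i) ×-dec (c ∈B? block i)) ≡⟨ sum-cong-≗ (λ i → per-block (block-distinct i)) ⟩
    ∑[ i < length bs ] (4 * 𝟙 (Q? (block i)))                     ≡⟨ *-distribˡ-sum 4 (λ i → 𝟙 (Q? (block i))) ⟨
    4 * ∑[ i < length bs ] 𝟙 (Q? (block i))                       ≡⟨ cong (4 *_) (count-lookup Q? bs) ⟨
    4 * length (filter Q? bs)                                     ∎
    where
    per-block : ∀ {B} → Distinct4 B → ∑[ c < v ] 𝟙 (Q? B ×-dec (c ∈B? B)) ≡ 4 * 𝟙 (Q? B)
    per-block {B} D = begin
      ∑[ c < v ] 𝟙 (Q? B ×-dec (c ∈B? B))   ≡⟨ sum-cong-≗ (λ c → 𝟙-× (Q? B) (c ∈B? B)) ⟩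
      ∑[ c < v ] (𝟙 (Q? B) * 𝟙 (c ∈B? B))   ≡⟨ *-distribˡ-sum (𝟙 (Q? B)) (λ c → 𝟙 (c ∈B? B)) ⟨
      𝟙 (Q? B) * ∑[ c < v ] 𝟙 (c ∈B? B)     ≡⟨ cong (𝟙 (Q? B) *_) (∑-∈B B D) ⟩
      𝟙 (Q? B) * 4                          ≡⟨ *-comm (𝟙 (Q? B)) 4 ⟩
      4 * 𝟙 (Q? B)                          ∎

  ∑-count-hasPair : ∀ a → ∑[ c < v ] length (filter (hasPair? a c) bs) ≡ length (filter (a ∈B?_) bs)
  ∑-count-hasPair a = begin
    ∑[ c < v ] length (filter (hasPair? a c) bs)           ≡⟨ ∑-count-comm (hasPair? a) ⟩
    ∑[ i < length bs ] ∑[ c < v ] 𝟙 (hasPair? a c (block i)) ≡⟨ sum-cong-≗ (λ i → ∑-hasPair (block i) (block-distinct i) a) ⟩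
    ∑[ i < length bs ] 𝟙 (a ∈B? block i)                     ≡⟨ count-lookup (a ∈B?_) bs ⟨
    length (filter (a ∈B?_) bs)                            ∎

-- Degrees and multiplicities in a nested SQS

module _ {v} (S : NestedSQS v) where

  degree : Fin v → ℕ
  degree a = length (filter (a ∈B?_) (blocks S))

  pairDegree : Fin v → Fin v → ℕ
  pairDegree a b = length (filter (λ B → (a ∈B? B) ×-dec (b ∈B? B)) (blocks S))

  tripleDegree : Fin v → Fin v → Fin v → ℕ
  tripleDegree a b c = length (filter (containsTriple? a b c) (blocks S))

  pairDegree-diagonal : ∀ a → pairDegree a a ≡ degree a
  pairDegree-diagonal a = count-≐ _ (a ∈B?_) ((λ (p , _) → p) , (λ p → p , p)) (blocks S)

  ∑-pairDegree : ∀ a → ∑[ c < v ] pairDegree a c ≡ 4 * degree a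
  ∑-pairDegree a = ∑-count-∈B (distinct S) (a ∈B?_)

  ∑-tripleDegree : ∀ a b → ∑[ c < v ] tripleDegree a b c ≡ 4 * pairDegree a b
  ∑-tripleDegree a b =
    trans (sum-cong-≗ (λ c → count-≐ (containsTriple? a b c) _ (assocˡ′ , assocʳ′) (blocks S)))
          (∑-count-∈B (distinct S) (λ B → (a ∈B? B) ×-dec (b ∈B? B)))

  v≡2+2*pairDegree : ∀ {a b} → a ≢ b → v ≡ 2 + 2 * pairDegree a b
  v≡2+2*pairDegree {a} {b} a≢b = begin
    v              ≡⟨ count-points ⟩
    1 + (1 + R)    ≡⟨ cong (2 +_) R≡2*l ⟩
    2 + 2 * l      ∎
    where
    l : ℕ
    l = pairDegree a b
    R : ℕ
    R = ∑[ c < v ] (𝟙 (¬? (c ≟ b)) * (𝟙 (¬? (c ≟ a)) * 1))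
    four : ∀ l → 4 * l ≡ (l + l) + 2 * l
    four = solve-∀
    off-ab : ∀ c → 𝟙 (¬? (c ≟ b)) * (𝟙 (¬? (c ≟ a)) * tripleDegree a b c) ≡ 𝟙 (¬? (c ≟ b)) * (𝟙 (¬? (c ≟ a)) * 1)
    off-ab c with c ≟ a | c ≟ b
    ... | yes _   | _       = refl
    ... | no _    | yes _   = refl
    ... | no c≢a  | no c≢b  = cong (λ t → 1 * (1 * t)) (steiner S a b c a≢b (≢-sym c≢a) (≢-sym c≢b))
    count-points : v ≡ 1 + (1 + R)
    count-points = trans (sym (trans (∑-const v 1) (*-identityʳ v))) (∑-extract₂ a≢b (λ _ → 1))
    count-triples : 4 * l ≡ l + (l + R)
    count-triples = begin
      4 * l                                  ≡⟨ ∑-tripleDegree a b ⟨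
      ∑[ c < v ] tripleDegree a b c          ≡⟨ ∑-extract₂ a≢b (tripleDegree a b) ⟩
      tripleDegree a b a + (tripleDegree a b b + ∑[ c < v ] (𝟙 (¬? (c ≟ b)) * (𝟙 (¬? (c ≟ a)) * tripleDegree a b c)))
        ≡⟨ cong₂ _+_ at-a (cong₂ _+_ at-b (sum-cong-≗ off-ab)) ⟩
      l + (l + R)                            ∎
      where
      at-a : tripleDegree a b a ≡ l
      at-a = count-≐ _ _ ((λ (p , q , _) → p , q) , (λ (p , q) → p , q , p)) (blocks S)
      at-b : tripleDegree a b b ≡ l
      at-b = count-≐ _ _ ((λ (p , q , _) → p , q) , (λ (p , q) → p , q , q)) (blocks S)
    R≡2*l : R ≡ 2 * l
    R≡2*l = +-cancelˡ-≡ (l + l) R (2 * l) (trans (+-assoc l l R) (trans (sym count-triples) (four l)))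

  pairDegree-constant : ∀ {a b c d} → a ≢ b → c ≢ d → pairDegree a b ≡ pairDegree c d
  pairDegree-constant a≢b c≢d =
    *-cancelˡ-≡ _ _ 2 (+-cancelˡ-≡ 2 _ _ (trans (sym (v≡2+2*pairDegree a≢b)) (v≡2+2*pairDegree c≢d)))

  others≡1+2*pairDegree : ∀ {e f} → e ≢ f → ∀ a → ∑[ c < v ] 𝟙 (¬? (c ≟ a)) ≡ 1 + 2 * pairDegree e f
  others≡1+2*pairDegree e≢f a = suc-injective (trans (1+∑-≢ a) (v≡2+2*pairDegree e≢f))

  3*degree≡[1+2*pairDegree]*pairDegree : ∀ {e f} → e ≢ f → ∀ a →
                                          3 * degree a ≡ (1 + 2 * pairDegree e f) * pairDegree e f
  3*degree≡[1+2*pairDegree]*pairDegree {e} {f} e≢f a = +-cancelˡ-≡ (degree a) _ _ (begin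
    4 * degree a                                          ≡⟨ ∑-pairDegree a ⟨
    ∑[ c < v ] pairDegree a c                             ≡⟨ ∑-extract a (pairDegree a) ⟩
    pairDegree a a + ∑[ c < v ] (𝟙 (¬? (c ≟ a)) * pairDegree a c)
                                                          ≡⟨ cong₂ _+_ (pairDegree-diagonal a) (sum-cong-≗ off-diagonal) ⟩
    degree a + ∑[ c < v ] (𝟙 (¬? (c ≟ a)) * l)           ≡⟨ +-congˡ (*-distribʳ-sum l (λ c → 𝟙 (¬? (c ≟ a)))) ⟨
    degree a + ∑[ c < v ] 𝟙 (¬? (c ≟ a)) * l             ≡⟨ +-congˡ (cong (_* l) (others≡1+2*pairDegree e≢f a)) ⟩
    degree a + (1 + 2 * l) * l                            ∎)
    where
    l : ℕ
    l = pairDegree e f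
    off-diagonal : ∀ c → 𝟙 (¬? (c ≟ a)) * pairDegree a c ≡ 𝟙 (¬? (c ≟ a)) * l
    off-diagonal c with c ≟ a
    ... | yes _  = refl
    ... | no c≢a = cong (1 *_) (pairDegree-constant (≢-sym c≢a) e≢f)

  ∑-mult : ∀ a → ∑[ c < v ] mult S a c ≡ degree a
  ∑-mult = ∑-count-hasPair (distinct S)

  mult-diagonal : ∀ a → mult S a a ≡ 0
  mult-diagonal a = cong length (filter-none (hasPair? a a) (All.tabulate (λ {B} B∈ → no-loop B (distinct S B B∈))))
    where
    no-loop : ∀ B → Distinct4 B → ¬ HasPair a a B
    no-loop ⟪ x , y ∣ z , w ⟫ (x≢y , _ , _ , _ , _ , z≢w) (inj₁ (inj₁ (refl , refl))) = x≢y refl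
    no-loop ⟪ x , y ∣ z , w ⟫ (x≢y , _ , _ , _ , _ , z≢w) (inj₁ (inj₂ (refl , refl))) = x≢y refl
    no-loop ⟪ x , y ∣ z , w ⟫ (x≢y , _ , _ , _ , _ , z≢w) (inj₂ (inj₁ (refl , refl))) = z≢w refl
    no-loop ⟪ x , y ∣ z , w ⟫ (x≢y , _ , _ , _ , _ , z≢w) (inj₂ (inj₂ (refl , refl))) = z≢w refl

  mult-sym : ∀ a b → mult S a b ≡ mult S b a
  mult-sym a b = count-≐ (hasPair? a b) (hasPair? b a) (HasPair-sym , HasPair-sym) (blocks S)
    where
    SamePair-sym : ∀ {a b p q : Fin v} → SamePair a b p q → SamePair b a p q
    SamePair-sym = Sum.swap ∘ Sum.map swap swap
    HasPair-sym : ∀ {a b} {B : NBlock v} → HasPair a b B → HasPair b a B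
    HasPair-sym {B = ⟪ _ , _ ∣ _ , _ ⟫} = Sum.map SamePair-sym SamePair-sym

  partnersWithMult : Fin v → ℕ → ℕ
  partnersWithMult a k = ∑[ c < v ] (𝟙 (¬? (c ≟ a)) * 𝟙 (mult S a c ℕ.≟ k))

  1≤partnersWithMult : ∀ {a c k} → a ≢ c → mult S a c ≡ k → 1 ≤ partnersWithMult a k
  1≤partnersWithMult {a} {c} {k} a≢c mult≡k = ≤-trans (≤-reflexive (sym term≡1)) (∑-term c F)
    where
    F : Fin v → ℕ
    F c′ = 𝟙 (¬? (c′ ≟ a)) * 𝟙 (mult S a c′ ℕ.≟ k)
    term≡1 : F c ≡ 1
    term≡1 = cong₂ _*_ (𝟙-yes (≢-sym a≢c) (¬? (c ≟ a))) (𝟙-yes mult≡k (mult S a c ℕ.≟ k))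

  2*pairsWithMult : ∀ k → 2 * pairsWithMult S k ≡ ∑[ a < v ] partnersWithMult a k
  2*pairsWithMult k = sym (begin
    ∑[ a < v ] ∑[ c < v ] (𝟙 (¬? (c ≟ a)) * M a c)
      ≡⟨ ∑∑-≢≡2*∑∑-< M (λ a c → cong (λ n → 𝟙 (n ℕ.≟ k)) (mult-sym a c)) ⟩
    2 * ∑[ a < v ] ∑[ c < v ] (𝟙 (a <? c) * M a c)   ≡⟨ cong (2 *_) ordered-pairs ⟨
    2 * pairsWithMult S k                            ∎)
    where
    M : Fin v → Fin v → ℕ
    M a c = 𝟙 (mult S a c ℕ.≟ k)
    ordered-pairs : pairsWithMult S k ≡ ∑[ a < v ] ∑[ c < v ] (𝟙 (a <? c) * M a c)
    ordered-pairs = begin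
      pairsWithMult S k
        ≡⟨ count-filter (λ (a , c) → mult S a c ℕ.≟ k) (λ (a , c) → a <? c) (cartesianProduct (allFin v) (allFin v)) ⟩
      length (filter (λ (a , c) → (a <? c) ×-dec (mult S a c ℕ.≟ k)) (cartesianProduct (allFin v) (allFin v)))
        ≡⟨ count-cartesianProduct (λ (a , c) → (a <? c) ×-dec (mult S a c ℕ.≟ k)) (λ a → a) (λ c → c) ⟩
      ∑[ a < v ] ∑[ c < v ] 𝟙 ((a <? c) ×-dec (mult S a c ℕ.≟ k))
        ≡⟨ sum-cong-≗ (λ a → sum-cong-≗ (λ c → 𝟙-× (a <? c) (mult S a c ℕ.≟ k))) ⟩
      ∑[ a < v ] ∑[ c < v ] (𝟙 (a <? c) * M a c)      ∎

-- Arithmetic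

between : ∀ {m x} → m ≤ x → x ≤ m + 1 → x ≡ m ⊎ x ≡ suc m
between {m} {x} m≤x x≤m+1 with m≤n⇒m<n∨m≡n m≤x
... | inj₂ m≡x = inj₁ (sym m≡x)
... | inj₁ m<x = inj₂ (≤-antisym (≤-trans x≤m+1 (≤-reflexive (+-comm m 1))) m<x)

level-split : ∀ {m x} → x ≡ m ⊎ x ≡ suc m → x ≡ m + 𝟙 (x ℕ.≟ suc m)
level-split {m} (inj₁ refl) = sym (trans (+-congˡ (𝟙-no (<⇒≢ (n<1+n m)) (m ℕ.≟ suc m))) (+-identityʳ m))
level-split {m} (inj₂ refl) = trans (+-comm 1 m) (+-congˡ (sym (𝟙-yes refl (suc m ℕ.≟ suc m))))

level-partition : ∀ {m x} → x ≡ m ⊎ x ≡ suc m → 𝟙 (x ℕ.≟ m) + 𝟙 (x ℕ.≟ suc m) ≡ 1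
level-partition {m} (inj₁ refl) = cong₂ _+_ (𝟙-yes refl (m ℕ.≟ m)) (𝟙-no (<⇒≢ (n<1+n m)) (m ℕ.≟ suc m))
level-partition {m} (inj₂ refl) = cong₂ _+_ (𝟙-no (>⇒≢ (n<1+n m)) (suc m ℕ.≟ m)) (𝟙-yes refl (suc m ℕ.≟ suc m))

m∸n≡1+o⇒m≡1+o+n : ∀ {m n o} → m ∸ n ≡ suc o → m ≡ suc o + n
m∸n≡1+o⇒m≡1+o+n {m} {n} m∸n≡1+o =
  trans (sym (m∸n+n≡m {m} {n} (<⇒≤ (m∸n≢0⇒n<m (λ m∸n≡0 → 1+n≢0 (trans (sym m∸n≡1+o) m∸n≡0))))))
        (+-congʳ m∸n≡1+o)

x*3≢1+k*3 : ∀ x k → x * 3 ≢ 1 + k * 3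
x*3≢1+k*3 x k eq = contradiction (trans (sym (m*n%n≡0 x 3)) (trans (cong (_% 3) eq) ([m+kn]%n≡m%n 1 k 3))) λ ()

pairDegree-forced : ∀ {l m X} → 3 * (m * (1 + 2 * l) + X) ≡ (1 + 2 * l) * l → 0 < X → X < 1 + 2 * l →
                    l ≡ 1 + m * 3
pairDegree-forced {l} {m} {X} eq 0<X X<d = by-cases (l ∸ m * 3) refl
  where
  d : ℕ
  d = 1 + 2 * l
  3X≡d*[l∸3m] : 3 * X ≡ d * (l ∸ m * 3)
  3X≡d*[l∸3m] = begin
    3 * X                              ≡⟨ m+n∸m≡n (3 * (m * d)) (3 * X) ⟨
    3 * (m * d) + 3 * X ∸ 3 * (m * d)  ≡⟨ cong (_∸ 3 * (m * d)) (trans (sym (*-distribˡ-+ 3 (m * d) X)) eq) ⟩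
    d * l ∸ 3 * (m * d)                ≡⟨ cong (d * l ∸_) (reorder m d) ⟩
    d * l ∸ d * (m * 3)                ≡⟨ *-distribˡ-∸ d l (m * 3) ⟨
    d * (l ∸ m * 3)                    ∎
    where
    reorder : ∀ m d → 3 * (m * d) ≡ d * (m * 3)
    reorder = solve-∀
  by-cases : ∀ s → l ∸ m * 3 ≡ s → l ≡ 1 + m * 3
  by-cases 0 s≡0 = contradiction (m+n≡0⇒m≡0 X (trans 3X≡d*[l∸3m] (trans (cong (d *_) s≡0) (*-zeroʳ d)))) (>⇒≢ 0<X)
  by-cases 1 s≡1 = m∸n≡1+o⇒m≡1+o+n {l} {m * 3} s≡1
  by-cases 2 s≡2 = contradiction (begin
    X * 3                      ≡⟨ *-comm X 3 ⟩
    3 * X                      ≡⟨ trans 3X≡d*[l∸3m] (cong (d *_) s≡2) ⟩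
    (1 + 2 * l) * 2            ≡⟨ cong (λ l → (1 + 2 * l) * 2) (m∸n≡1+o⇒m≡1+o+n {l} {m * 3} s≡2) ⟩
    (1 + 2 * (2 + m * 3)) * 2  ≡⟨ rearrange m ⟩
    1 + (3 + m * 4) * 3        ∎) (x*3≢1+k*3 X (3 + m * 4))
    where
    rearrange : ∀ m → (1 + 2 * (2 + m * 3)) * 2 ≡ 1 + (3 + m * 4) * 3
    rearrange = solve-∀
  by-cases (suc (suc (suc k))) s≡3+k = contradiction X<d (≤⇒≯ (*-cancelˡ-≤ 3 3d≤3X))
    where
    3d≤3X : 3 * d ≤ 3 * X
    3d≤3X = ≤-trans (≤-reflexive (*-comm 3 d))
              (≤-trans (*-monoʳ-≤ d (m≤m+n 3 k)) (≤-reflexive (sym (trans 3X≡d*[l∸3m] (cong (d *_) s≡3+k)))))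

partners-forced : ∀ {l m X} → l ≡ 1 + m * 3 → 3 * (m * (1 + 2 * l) + X) ≡ (1 + 2 * l) * l → X ≡ 1 + m * 2
partners-forced {m = m} {X} refl eq =
  +-cancelˡ-≡ (m * (1 + 2 * (1 + m * 3))) X (1 + m * 2) (*-cancelˡ-≡ _ _ 3 (trans eq (expand m)))
  where
  expand : ∀ m → (1 + 2 * (1 + m * 3)) * (1 + m * 3) ≡ 3 * (m * (1 + 2 * (1 + m * 3)) + (1 + m * 2))
  expand = solve-∀

module _ {v m : ℕ} where

  v%6≡4 : v ≡ 4 + m * 6 → v % 6 ≡ 4
  v%6≡4 refl = [m+kn]%n≡m%n 4 m 6

  [v∸4]/6≡m : v ≡ 4 + m * 6 → (v ∸ 4) / 6 ≡ m
  [v∸4]/6≡m refl = m*n/n≡m m 6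

  [v+2]/6≡1+m : v ≡ 4 + m * 6 → (v + 2) / 6 ≡ suc m
  [v+2]/6≡1+m refl = trans (cong (_/ 6) (regroup m)) (m*n/n≡m (suc m) 6)
    where
    regroup : ∀ m → 4 + m * 6 + 2 ≡ suc m * 6
    regroup = solve-∀

  2*p≡v*[2+m*4]⇒p≡v*[v∸1]/3 : ∀ {p} → v ≡ 4 + m * 6 → 2 * p ≡ v * (2 + m * 4) → p ≡ v * (v ∸ 1) / 3
  2*p≡v*[2+m*4]⇒p≡v*[v∸1]/3 {p} refl 2p≡ = begin
    p                                     ≡⟨ *-cancelˡ-≡ p _ 2 (trans 2p≡ (halve m)) ⟩
    (4 + m * 6) * (1 + m * 2)             ≡⟨ m*n/n≡m _ 3 ⟨
    (4 + m * 6) * (1 + m * 2) * 3 / 3     ≡⟨ cong (_/ 3) (regroup m) ⟩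
    (4 + m * 6) * (3 + m * 6) / 3         ∎
    where
    halve : ∀ m → (4 + m * 6) * (2 + m * 4) ≡ 2 * ((4 + m * 6) * (1 + m * 2))
    halve = solve-∀
    regroup : ∀ m → (4 + m * 6) * (1 + m * 2) * 3 ≡ (4 + m * 6) * (3 + m * 6)
    regroup = solve-∀

  2*p≡v*[1+m*2]⇒p≡v*[v∸1]/6 : ∀ {p} → v ≡ 4 + m * 6 → 2 * p ≡ v * (1 + m * 2) → p ≡ v * (v ∸ 1) / 6
  2*p≡v*[1+m*2]⇒p≡v*[v∸1]/6 {p} refl 2p≡ = begin
    p                                     ≡⟨ *-cancelˡ-≡ p _ 2 (trans 2p≡ (halve m)) ⟩
    (2 + m * 3) * (1 + m * 2)             ≡⟨ m*n/n≡m _ 6 ⟨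
    (2 + m * 3) * (1 + m * 2) * 6 / 6     ≡⟨ cong (_/ 6) (regroup m) ⟩
    (4 + m * 6) * (3 + m * 6) / 6         ∎
    where
    halve : ∀ m → (4 + m * 6) * (1 + m * 2) ≡ 2 * ((2 + m * 3) * (1 + m * 2))
    halve = solve-∀
    regroup : ∀ m → (2 + m * 3) * (1 + m * 2) * 6 ≡ (4 + m * 6) * (3 + m * 6)
    regroup = solve-∀

-- Quasi-uniform systems

TwoValued : ∀ {v} → NestedSQS v → ℕ → Set
TwoValued {v} S m = ∀ (a c : Fin v) → a ≢ c → mult S a c ≡ m ⊎ mult S a c ≡ suc m

Attained : ∀ {v} → NestedSQS v → ℕ → Set
Attained {v} S k = ∃[ a ] ∃[ c ] (a ≢ c × mult S a c ≡ k)

module _ {v} (S : NestedSQS v) where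

  twoLevels : ∀ {a b c d} → a ≢ b → c ≢ d →
              (∀ a b c d → a ≢ b → c ≢ d → mult S a b ≤ mult S c d + 1) →
              mult S a b < mult S c d →
              TwoValued S (mult S a b) × Attained S (mult S a b) × Attained S (suc (mult S a b))
  twoLevels {a} {b} {c} {d} a≢b c≢d near ab<cd =
    two-valued , (a , b , a≢b , refl) , c , d , c≢d , ≤-antisym (≤-trans (near c d a b c≢d a≢b) (≤-reflexive (+-comm _ 1))) ab<cd
    where
    two-valued : TwoValued S (mult S a b)
    two-valued x y x≢y = between (≤-pred (≤-trans ab<cd (≤-trans (near c d x y c≢d x≢y) (≤-reflexive (+-comm _ 1)))))
                                 (near x y a b x≢y a≢b)

  quasiUniform⇒twoLevels : CompletelyQuasiUniform S → ∃[ m ] (TwoValued S m × Attained S m × Attained S (suc m))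
  quasiUniform⇒twoLevels (positive , near , a , b , c , d , a≢b , c≢d , _ , _ , unequal) =
    by-order (<-cmp (mult S a b) (mult S c d))
    where
    near′ : ∀ a b c d → a ≢ b → c ≢ d → mult S a b ≤ mult S c d + 1
    near′ a b c d a≢b c≢d = near a b c d a≢b c≢d (positive a b a≢b) (positive c d c≢d)
    by-order : Tri (mult S a b < mult S c d) (mult S a b ≡ mult S c d) (mult S c d < mult S a b) →
               ∃[ m ] (TwoValued S m × Attained S m × Attained S (suc m))
    by-order (tri< ab<cd _ _) = _ , twoLevels a≢b c≢d near′ ab<cd
    by-order (tri≈ _ ab≡cd _) = contradiction ab≡cd unequal
    by-order (tri> _ _ cd<ab) = _ , twoLevels c≢d a≢b near′ cd<ab

module TwoLevels {v} (S : NestedSQS v) {m} (two-valued : TwoValued S m) {e f g h : Fin v}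
                 (e≢f : e ≢ f) (ef≡m : mult S e f ≡ m) (g≢h : g ≢ h) (gh≡1+m : mult S g h ≡ suc m) where

  private
    l : ℕ
    l = pairDegree S e f

  lightPartners heavyPartners : Fin v → ℕ
  lightPartners a = partnersWithMult S a m
  heavyPartners a = partnersWithMult S a (suc m)

  degree≡m*[1+2l]+heavyPartners : ∀ a → degree S a ≡ m * (1 + 2 * l) + heavyPartners a
  degree≡m*[1+2l]+heavyPartners a = begin
    degree S a                                              ≡⟨ ∑-mult S a ⟨
    ∑[ c < v ] mult S a c                                   ≡⟨ ∑-extract a (mult S a) ⟩
    mult S a a + ∑[ c < v ] (𝟙 (¬? (c ≟ a)) * mult S a c)  ≡⟨ cong₂ _+_ (mult-diagonal S a) (sum-cong-≗ split) ⟩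
    ∑[ c < v ] (m * 𝟙 (¬? (c ≟ a)) + 𝟙 (¬? (c ≟ a)) * 𝟙 (mult S a c ℕ.≟ suc m))
      ≡⟨ ∑-distrib-+ (λ c → m * 𝟙 (¬? (c ≟ a))) (λ c → 𝟙 (¬? (c ≟ a)) * 𝟙 (mult S a c ℕ.≟ suc m)) ⟩
    ∑[ c < v ] (m * 𝟙 (¬? (c ≟ a))) + heavyPartners a      ≡⟨ +-congʳ (*-distribˡ-sum m (λ c → 𝟙 (¬? (c ≟ a)))) ⟨
    m * ∑[ c < v ] 𝟙 (¬? (c ≟ a)) + heavyPartners a        ≡⟨ +-congʳ (cong (m *_) (others≡1+2*pairDegree S e≢f a)) ⟩
    m * (1 + 2 * l) + heavyPartners a                      ∎
    where
    split : ∀ c → 𝟙 (¬? (c ≟ a)) * mult S a c ≡ m * 𝟙 (¬? (c ≟ a)) + 𝟙 (¬? (c ≟ a)) * 𝟙 (mult S a c ℕ.≟ suc m)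
    split c with c ≟ a
    ... | yes _  = sym (trans (+-identityʳ (m * 0)) (*-zeroʳ m))
    ... | no c≢a = trans (*-identityˡ _) (trans (level-split (two-valued a c (≢-sym c≢a)))
                     (cong₂ _+_ (sym (*-identityʳ m)) (sym (*-identityˡ _))))

  lightPartners+heavyPartners≡1+2l : ∀ a → lightPartners a + heavyPartners a ≡ 1 + 2 * l
  lightPartners+heavyPartners≡1+2l a = sym (trans (sym (others≡1+2*pairDegree S e≢f a)) (trans (sum-cong-≗ split)
    (∑-distrib-+ (λ c → 𝟙 (¬? (c ≟ a)) * 𝟙 (mult S a c ℕ.≟ m)) (λ c → 𝟙 (¬? (c ≟ a)) * 𝟙 (mult S a c ℕ.≟ suc m)))))
    where
    split : ∀ c → 𝟙 (¬? (c ≟ a)) ≡ 𝟙 (¬? (c ≟ a)) * 𝟙 (mult S a c ℕ.≟ m) + 𝟙 (¬? (c ≟ a)) * 𝟙 (mult S a c ℕ.≟ suc m)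
    split c with c ≟ a
    ... | yes _  = refl
    ... | no c≢a = sym (trans (cong₂ _+_ (*-identityˡ (𝟙 (mult S a c ℕ.≟ m))) (*-identityˡ (𝟙 (mult S a c ℕ.≟ suc m))))
                                (level-partition (two-valued a c (≢-sym c≢a))))

  degree-equation : ∀ a → 3 * (m * (1 + 2 * l) + heavyPartners a) ≡ (1 + 2 * l) * l
  degree-equation a =
    trans (cong (3 *_) (sym (degree≡m*[1+2l]+heavyPartners a))) (3*degree≡[1+2*pairDegree]*pairDegree S e≢f a)

  heavyPartners-constant : ∀ a b → heavyPartners a ≡ heavyPartners b
  heavyPartners-constant a b =
    +-cancelˡ-≡ (m * (1 + 2 * l)) _ _ (*-cancelˡ-≡ _ _ 3 (trans (degree-equation a) (sym (degree-equation b))))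

  l≡1+m*3 : l ≡ 1 + m * 3
  l≡1+m*3 = pairDegree-forced {l} {m} (degree-equation e) 0<heavy heavy<1+2l
    where
    0<heavy : 0 < heavyPartners e
    0<heavy = ≤-trans (1≤partnersWithMult S g≢h gh≡1+m) (≤-reflexive (heavyPartners-constant g e))
    heavy<1+2l : heavyPartners e < 1 + 2 * l
    heavy<1+2l = ≤-trans (+-monoˡ-≤ (heavyPartners e) (1≤partnersWithMult S e≢f ef≡m))
                         (≤-reflexive (lightPartners+heavyPartners≡1+2l e))

  heavyPartners≡1+m*2 : ∀ a → heavyPartners a ≡ 1 + m * 2
  heavyPartners≡1+m*2 a = partners-forced {l} {m} l≡1+m*3 (degree-equation a)

  lightPartners≡2+m*4 : ∀ a → lightPartners a ≡ 2 + m * 4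
  lightPartners≡2+m*4 a = +-cancelʳ-≡ (1 + m * 2) _ _ (begin
    lightPartners a + (1 + m * 2)      ≡⟨ +-congˡ (heavyPartners≡1+m*2 a) ⟨
    lightPartners a + heavyPartners a  ≡⟨ lightPartners+heavyPartners≡1+2l a ⟩
    1 + 2 * l                          ≡⟨ cong (λ l → 1 + 2 * l) l≡1+m*3 ⟩
    1 + 2 * (1 + m * 3)                ≡⟨ regroup m ⟩
    (2 + m * 4) + (1 + m * 2)          ∎)
    where
    regroup : ∀ m → 1 + 2 * (1 + m * 3) ≡ (2 + m * 4) + (1 + m * 2)
    regroup = solve-∀

  v≡4+m*6 : v ≡ 4 + m * 6
  v≡4+m*6 = trans (v≡2+2*pairDegree S e≢f) (trans (cong (λ l → 2 + 2 * l) l≡1+m*3) (regroup m))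
    where
    regroup : ∀ m → 2 + 2 * (1 + m * 3) ≡ 4 + m * 6
    regroup = solve-∀

  2*pairsWithMult-light : 2 * pairsWithMult S m ≡ v * (2 + m * 4)
  2*pairsWithMult-light = trans (2*pairsWithMult S m) (trans (sum-cong-≗ lightPartners≡2+m*4) (∑-const v _))

  2*pairsWithMult-heavy : 2 * pairsWithMult S (suc m) ≡ v * (1 + m * 2)
  2*pairsWithMult-heavy = trans (2*pairsWithMult S (suc m)) (trans (sum-cong-≗ heavyPartners≡1+m*2) (∑-const v _))

theorem2p1 : (v : ℕ) → 0 < v → (S : NestedSQS v) → CompletelyQuasiUniform S →
    (v % 6 ≡ 4)
    × (∀ (a b : Fin v) → a ≢ b → (mult S a b ≡ (v ∸ 4) / 6) ⊎ (mult S a b ≡ (v + 2) / 6))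
    × (pairsWithMult S ((v ∸ 4) / 6) ≡ (v * (v ∸ 1)) / 3)
    × (pairsWithMult S ((v + 2) / 6) ≡ (v * (v ∸ 1)) / 6)
theorem2p1 v _ S quasiUniform with quasiUniform⇒twoLevels S quasiUniform
... | m , two-valued , (e , f , e≢f , ef≡m) , (g , h , g≢h , gh≡1+m) =
    v%6≡4 {m = m} v≡4+m*6
  , (λ a b a≢b → Sum.map (λ ab≡m → trans ab≡m (sym light-level)) (λ ab≡1+m → trans ab≡1+m (sym heavy-level))
                          (two-valued a b a≢b))
  , trans (cong (pairsWithMult S) light-level) (2*p≡v*[2+m*4]⇒p≡v*[v∸1]/3 {m = m} v≡4+m*6 2*pairsWithMult-light)
  , trans (cong (pairsWithMult S) heavy-level) (2*p≡v*[1+m*2]⇒p≡v*[v∸1]/6 {m = m} v≡4+m*6 2*pairsWithMult-heavy)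
  where
  open TwoLevels S two-valued e≢f ef≡m g≢h gh≡1+m using (v≡4+m*6; 2*pairsWithMult-light; 2*pairsWithMult-heavy)
  light-level : (v ∸ 4) / 6 ≡ m
  light-level = [v∸4]/6≡m {m = m} v≡4+m*6
  heavy-level : (v + 2) / 6 ≡ suc m
  heavy-level = [v+2]/6≡1+m {m = m} v≡4+m*6
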